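{- Let $G=(V,E)$ be an undirected connected graph, $c:E\to\mathbb{R}^d_{\geq0}$ an edge cost function, $s\in V$, and let $\mathcal{G}=(\mathcal{V},\mathcal{A})$ with arc costs $\gamma$ be the transition graph of $(G,c,s)$ defined below. Let $U\subseteq V$ with $s\in U$, and let $P$ be a minimum complete set of efficient $\{s\}$-$U$-paths in $\mathcal{G}$ with respect to $\gamma$. Then the set of trees $\{\{a^{ -1}: a\in p\} : p\in P\}$ (each path mapped to the set of preimage edges of its arcs) is a minimum complete set of efficient spanning trees of $G(U)$ with respect to $c$, and each path $p\in P$ has the same cost $\gamma(p)$ as the tree it is mapped to.
   Context: Trees in $G$ are connected acyclic subgraphs identified with their edge sets $t\subseteq E$, with node set $V(t)$ and cost $c(t)=\sum_{e\in t}c(e)$. A spanning tree of the induced subgraph $G(U)$ is a tree with node set $U$. Tree $t$ dominates tree $t'$ if $V(t)=V(t')$, $c(t)\leq c(t')$ componentwise and $c(t)\neq c(t')$; efficient = not dominated. For a finite set $Y\subset\mathbb{R}^d_{\geq0}$, $Y^*$ is its set of nondominated vectors. A minimum complete set of efficient spanning trees of $G(U)$ is a subset $T^*$ of the spanning trees $T$ of $G(U)$ of minimum cardinality with $\{c(t):t\in T^*\}=\{c(t):t\in T\}^*$. Cut: $\delta(U)=\{[u,w]\in E:u\in U,w\notin U\}$. Transition graph: the directed multigraph with node set $\mathcal{V}=\{U\subseteq V: s\in U\}$; for every $U\in\mathcal{V}$ and every edge $[u,w]\in\delta(U)$ with $u\in U$, $w\notin U$ there is an arc $(U,U\cup\{w\})$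 (so parallel arcs exist), whose preimage edge is $(U,U\cup\{w\})^{ -1}=[u,w]$, with cost $\gamma(a)=c(a^{ -1})$. The cost of a path is the sum of its arc costs. An $\{s\}$-$U$-path $p$ dominates another $\{s\}$-$U$-path $p'$ if $\gamma(p)\leq\gamma(p')$ and $\gamma(p)\neq\gamma(p')$; efficient = not dominated. A minimum complete set of efficient $\{s\}$-$U$-paths is a set $P$ of $\{s\}$-$U$-paths of minimum cardinality with $\gamma(P)$ equal to the set of nondominated vectors among the costs of all $\{s\}$-$U$-paths. -}

module Defs where

open import Data.Nat using (ℕ; zero; suc; _≤_)
open import Data.Fin using (Fin; zero; suc)
open import Data.Fin.Subset using (Subset; inside; outside; _∈_; _∉_; _∪_; _-_; ⁅_⁆)
open import Data.Vec using (Vec; []; _∷_; zipWith; replicate; lookup)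
open import Data.Vec.Relation.Binary.Pointwise.Inductive using (Pointwise)
open import Data.Product using (_×_; _,_; proj₁; proj₂; Σ; ∃; ∃-syntax)
open import Data.Sum using (_⊎_)
open import Data.List using (List; length; map)
open import Data.List.Membership.Propositional as LM using ()
open import Data.List.Relation.Unary.Unique.Propositional using (Unique)
open import Relation.Binary.PropositionalEquality using (_≡_; _≢_)
open import Relation.Binary.Structures using (IsPartialOrder)
open import Relation.Nullary using (¬_)

-- Cost scalars: an abstract partially ordered commutative monoid
-- (ℝ with +, 0 and ≤ is an instance; costs are vectors in Carrier^d,
-- and nonnegativity is an explicit hypothesis of the theorem).

record CostMonoid : Set₁ where
  infixl 6 _+_
  infix 4 _≤ᶜ_
  field
    Carrier        : Set
    _+_            : Carrier → Carrier → Carrier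
    0#             : Carrier
    _≤ᶜ_           : Carrier → Carrier → Set
    isPartialOrder : IsPartialOrder _≡_ _≤ᶜ_
    +-assoc        : ∀ x y z → (x + y) + z ≡ x + (y + z)
    +-comm         : ∀ x y → x + y ≡ y + x
    +-identityˡ    : ∀ x → 0# + x ≡ x
    +-mono-≤       : ∀ {x y u v} → x ≤ᶜ y → u ≤ᶜ v → x + u ≤ᶜ y + v

module _ (C : CostMonoid) {d : ℕ} where
  open CostMonoid C

  Cost : Set
  Cost = Vec Carrier d

  _⊕_ : Cost → Cost → Cost
  _⊕_ = zipWith _+_

  𝟎 : Cost
  𝟎 = replicate d 0#

  _≤v_ : Cost → Cost → Set
  _≤v_ = Pointwise _≤ᶜ_

  Dominates : Cost → Cost → Set
  Dominates y y' = (y ≤v y') × (y ≢ y')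

  NonNeg : Cost → Set
  NonNeg y = 𝟎 ≤v y

  costSum : {m : ℕ} → (Fin m → Cost) → Subset m → Cost
  costSum {zero}  f []            = 𝟎
  costSum {suc m} f (inside ∷ t)  = f zero ⊕ costSum (λ e → f (suc e)) t
  costSum {suc m} f (outside ∷ t) = costSum (λ e → f (suc e)) t

module _ {n m : ℕ} (ends : Fin m → Fin n × Fin n) where

  Joins : Fin m → Fin n → Fin n → Set
  Joins e u w = (ends e ≡ (u , w)) ⊎ (ends e ≡ (w , u))

  Simple : Set
  Simple = (∀ e → proj₁ (ends e) ≢ proj₂ (ends e))
         × (∀ e e' u w → Joins e u w → Joins e' u w → e ≡ e')

  data Conn (t : Subset m) : Fin n → Fin n → Set where
    here : ∀ {u} → Conn t u u
    step : ∀ {u x v} (e : Fin m) → e ∈ t → Joins e u x → Conn t x v → Conn t u v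

  Connected : Set
  Connected = ∀ u v → Conn (Data.Fin.Subset.⊤) u v

  -- acyclic: no edge of t lies on a cycle of t, i.e. removing any edge
  -- of t disconnects its endpoints
  Acyclic : Subset m → Set
  Acyclic t = ∀ e → e ∈ t → ¬ Conn (t - e) (proj₁ (ends e)) (proj₂ (ends e))

  SpanningTree : Subset n → Subset m → Set
  SpanningTree U t = (∀ e → e ∈ t → proj₁ (ends e) ∈ U × proj₂ (ends e) ∈ U)
                   × (∀ u v → u ∈ U → v ∈ U → Conn t u v)
                   × Acyclic t

  -- Nodes: subsets containing s.  An arc from W is
  -- given by an edge e = [u,w] of the cut δ(W), u ∈ W, w ∉ W (stated as
  -- lookup W w ≡ outside, a proof-irrelevant form of w ∉ W), and leads to
  -- W ∪ {w}; its preimage edge is e.  (Parallel arcs = different edges.)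

  data Arc (W : Subset n) : Subset n → Set where
    arc : (e : Fin m) (u w : Fin n) → Joins e u w → u ∈ W → lookup W w ≡ outside
        → Arc W (W ∪ ⁅ w ⁆)

  arcEdge : ∀ {W W'} → Arc W W' → Fin m
  arcEdge (arc e _ _ _ _ _) = e

  data TPath : Subset n → Subset n → Set where
    []  : ∀ {W} → TPath W W
    _∷_ : ∀ {W W' W''} → Arc W W' → TPath W' W'' → TPath W W''

  pathEdges : ∀ {W W'} → TPath W W' → Subset m
  pathEdges []      = Data.Fin.Subset.⊥
  pathEdges (a ∷ p) = ⁅ arcEdge a ⁆ ∪ pathEdges p

  module _ (C : CostMonoid) {d : ℕ} (c : Fin m → Cost C {d}) where

    treeCost : Subset m → Cost C
    treeCost t = costSum C c t

    pathCost : ∀ {W W'} → TPath W W' → Cost C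
    pathCost []      = 𝟎 C
    pathCost (a ∷ p) = _⊕_ C (c (arcEdge a)) (pathCost p)

    EfficientTree : Subset n → Subset m → Set
    EfficientTree U t = SpanningTree U t
      × ¬ (∃[ t' ] (SpanningTree U t' × Dominates C (treeCost t') (treeCost t)))

    CompleteTrees : Subset n → List (Subset m) → Set
    CompleteTrees U T = (∀ t → t LM.∈ T → EfficientTree U t)
      × (∀ t → EfficientTree U t → ∃[ t' ] (t' LM.∈ T × treeCost t' ≡ treeCost t))

    MinCompleteTrees : Subset n → List (Subset m) → Set
    MinCompleteTrees U T = Unique T × CompleteTrees U T
      × (∀ T' → Unique T' → CompleteTrees U T' → length T ≤ length T')

    EfficientPath : (s : Fin n) (U : Subset n) → TPath ⁅ s ⁆ U → Set
    EfficientPath s U p =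
      ¬ (Σ (TPath ⁅ s ⁆ U) λ p' → Dominates C (pathCost p') (pathCost p))

    CompletePaths : (s : Fin n) (U : Subset n) → List (TPath ⁅ s ⁆ U) → Set
    CompletePaths s U P = (∀ p → p LM.∈ P → EfficientPath s U p)
      × (∀ p → EfficientPath s U p
           → Σ (TPath ⁅ s ⁆ U) λ p' → p' LM.∈ P × pathCost p' ≡ pathCost p)

    MinCompletePaths : (s : Fin n) (U : Subset n) → List (TPath ⁅ s ⁆ U) → Set
    MinCompletePaths s U P = Unique P × CompletePaths s U P
      × (∀ P' → Unique P' → CompletePaths s U P' → length P ≤ length P')

{-# OPTIONS --safe #-}
module Submission where

-- A path from {s} to U in the transition graph is a run of Prim's algorithm:
-- each arc adds a node w outside the current node set W together with an edge
-- joining w to W.  Such an edge is pendant in the grown edge set, so the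
-- preimage edges of a path form a spanning tree of G(U); and as each edge leaves
-- the node set it was chosen from, the edges are pairwise distinct and the path
-- and the tree have the same cost.  Conversely, running Prim's algorithm with the
-- edges of a given spanning tree of G(U) recovers that tree.  Hence p ↦ {a⁻¹ : a ∈ p}
-- is a cost-preserving map from paths onto spanning trees which preserves and
-- reflects efficiency; complete sets are mapped to complete sets, and complete
-- sets of trees lift to complete sets of paths of the same size.  Finally, the
-- members of a minimum complete set have pairwise distinct costs, so distinct
-- paths of P have distinct trees.

open import Defs
open import Data.Fin using (Fin; zero; suc)
open import Data.Fin.Properties using (any?) renaming (_≟_ to _≟ᶠ_)
open import Data.Fin.Subset using (Subset; ∣_∣; inside; outside; _∈_; _∉_; _⊆_; _∪_; _-_; _─_; ⁅_⁆)
import Data.Fin.Subset as Subset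
open import Data.Fin.Subset.Properties
  using (∉⊥; x∈⁅x⁆; x∈⁅y⁆⇒x≡y; x∈p∪q⁻; p⊆p∪q; q⊆p∪q; ∪-identityˡ; ∪-identityʳ; ∪-assoc;
         x∈p∧x≢y⇒x∈p-y; p─q⊆p; _∈?_; ⊆-antisym; p⊂q⇒∣p∣<∣q∣; ∣p∣≤n)
open import Data.List using (List; []; _∷_; map; length)
open import Data.List.Properties using (length-map; length-removeAt′)
open import Data.List.Membership.Propositional using () renaming (_∈_ to _∈ˡ_)
open import Data.List.Membership.Propositional.Properties using (∈-map⁺; ∈-map⁻)
open import Data.List.Relation.Unary.All as All using (All; []; _∷_)
open import Data.List.Relation.Unary.All.Properties using (─⁺)
open import Data.List.Relation.Unary.AllPairs using (AllPairs; []; _∷_)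
import Data.List.Relation.Unary.AllPairs.Properties as AllPairs
open import Data.List.Relation.Unary.Any using (here; there) renaming (_─_ to _─ˡ_)
open import Data.List.Relation.Unary.Unique.Propositional using (Unique)
import Data.List.Relation.Unary.Unique.Propositional.Properties as Unique
open import Data.Nat using (ℕ; _≤_; _<_; _∸_)
open import Data.Nat.Induction using (<-wellFounded)
open import Data.Nat.Properties using (≤-trans; ≤-reflexive; n≮n; ∸-monoʳ-<; module ≤-Reasoning)
import Data.Product as Product
open import Data.Product using (_×_; _,_; proj₁; proj₂; Σ; ∃-syntax)
open import Data.Product.Properties using (,-injectiveˡ; ,-injectiveʳ)
import Data.Sum as Sum
open import Data.Sum using (_⊎_; inj₁; inj₂)
open import Data.Vec using ([]; _∷_; lookup; here; there)
open import Data.Vec.Properties using ([]=⇒lookup; lookup⇒[]=)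
open import Function using (_∘_)
open import Induction.WellFounded using (Acc; acc)
open import Relation.Binary.PropositionalEquality
open import Relation.Nullary using (¬_; yes; no; contradiction)
open import Relation.Nullary.Decidable using (_×-dec_; ¬?; decidable-stable)

module _ {A : Set} where

  ∈─ˡ⇒∈ : ∀ {x y} {xs : List A} (i : x ∈ˡ xs) → y ∈ˡ (xs ─ˡ i) → y ∈ˡ xs
  ∈─ˡ⇒∈ (here _)  y∈        = there y∈
  ∈─ˡ⇒∈ (there i) (here eq) = here eq
  ∈─ˡ⇒∈ (there i) (there y∈) = there (∈─ˡ⇒∈ i y∈)

  ∈⇒≡⊎∈─ˡ : ∀ {x y} {xs : List A} (i : x ∈ˡ xs) → y ∈ˡ xs → y ≡ x ⊎ y ∈ˡ (xs ─ˡ i)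
  ∈⇒≡⊎∈─ˡ (here refl) (here refl) = inj₁ refl
  ∈⇒≡⊎∈─ˡ (here _)    (there y∈)  = inj₂ y∈
  ∈⇒≡⊎∈─ˡ (there i)   (here eq)   = inj₂ (here eq)
  ∈⇒≡⊎∈─ˡ (there i)   (there y∈)  with ∈⇒≡⊎∈─ˡ i y∈
  ... | inj₁ y≡x   = inj₁ y≡x
  ... | inj₂ y∈xs─i = inj₂ (there y∈xs─i)

  Unique-─ˡ : ∀ {x} {xs : List A} (i : x ∈ˡ xs) → Unique xs → Unique (xs ─ˡ i)
  Unique-─ˡ (here _)  (_ ∷ unique)       = unique
  Unique-─ˡ (there i) (x∉xs ∷ unique) = ─⁺ i x∉xs ∷ Unique-─ˡ i unique

  AllPairs-mapWith∈ : ∀ {R S : A → A → Set} {xs : List A}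
    → (∀ {x y} → x ∈ˡ xs → y ∈ˡ xs → R x y → S x y) → AllPairs R xs → AllPairs S xs
  AllPairs-mapWith∈ f []           = []
  AllPairs-mapWith∈ f (rx ∷ rxs) =
    All.tabulate (λ y∈ → f (here refl) (there y∈) (All.lookup rx y∈))
    ∷ AllPairs-mapWith∈ (λ x∈ y∈ → f (there x∈) (there y∈)) rxs

-- MinCompletePaths and MinCompleteTrees are instances of IsMinimumComplete.
module _ {A X : Set} (Efficient : A → Set) (cost : A → X) where

  IsComplete : List A → Set
  IsComplete L = (∀ a → a ∈ˡ L → Efficient a)
               × (∀ a → Efficient a → ∃[ a′ ] (a′ ∈ˡ L × cost a′ ≡ cost a))

  IsMinimumComplete : List A → Set
  IsMinimumComplete L = Unique L × IsComplete L
    × (∀ L′ → Unique L′ → IsComplete L′ → length L ≤ length L′)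

  -- Otherwise y could be dropped from L, since x has the same cost.
  minimumComplete⇒cost-injective : ∀ {L x y} → IsMinimumComplete L → x ∈ˡ L → y ∈ˡ L
    → x ≢ y → cost x ≢ cost y
  minimumComplete⇒cost-injective {L} {x} {y} (unique , (efficient , covers) , minimum) x∈ y∈ x≢y cx≡cy =
    n≮n (length (L ─ˡ y∈))
      (≤-trans (≤-reflexive (sym (length-removeAt′ L _)))
               (minimum (L ─ˡ y∈) (Unique-─ˡ y∈ unique) complete))
    where
    covers′ : ∀ a → Efficient a → ∃[ a′ ] (a′ ∈ˡ (L ─ˡ y∈) × cost a′ ≡ cost a)
    covers′ a eff with covers a eff
    ... | a′ , a′∈ , ca′≡ca with ∈⇒≡⊎∈─ˡ y∈ a′∈
    ...   | inj₂ a′∈L─y = a′ , a′∈L─y , ca′≡ca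
    ...   | inj₁ refl with ∈⇒≡⊎∈─ˡ y∈ x∈
    ...     | inj₁ x≡y   = contradiction x≡y x≢y
    ...     | inj₂ x∈L─y = x , x∈L─y , trans cx≡cy ca′≡ca
    complete : IsComplete (L ─ˡ y∈)
    complete = (λ a a∈ → efficient a (∈─ˡ⇒∈ y∈ a∈)) , covers′

module _ {A B X : Set} {EfficientA : A → Set} {EfficientB : B → Set}
         {costA : A → X} {costB : B → X} (g : A → B)
         (g-cost : ∀ a → costA a ≡ costB (g a))
         (g-efficient : ∀ a → EfficientA a → EfficientB (g a))
         (g-efficient⁻ : ∀ a → EfficientB (g a) → EfficientA a)
         (g-onto : ∀ b → EfficientB b → ∃[ a ] g a ≡ b) where

  private
    CompleteA = IsComplete EfficientA costA
    CompleteB = IsComplete EfficientB costB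

  complete-map : ∀ {L} → CompleteA L → CompleteB (map g L)
  complete-map {L} (efficient , covers) = efficient′ , covers′
    where
    efficient′ : ∀ b → b ∈ˡ map g L → EfficientB b
    efficient′ b b∈ with ∈-map⁻ g b∈
    ... | a , a∈ , refl = g-efficient a (efficient a a∈)
    covers′ : ∀ b → EfficientB b → ∃[ b′ ] (b′ ∈ˡ map g L × costB b′ ≡ costB b)
    covers′ b eff with g-onto b eff
    ... | a , refl with covers a (g-efficient⁻ a eff)
    ...   | a′ , a′∈ , ca′≡ca =
      g a′ , ∈-map⁺ g a′∈ , trans (sym (g-cost a′)) (trans ca′≡ca (g-cost a))

  map-preimage : ∀ {M} → All (λ b → ∃[ a ] g a ≡ b) M → ∃[ L ] map g L ≡ M
  map-preimage []                    = [] , refl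
  map-preimage ((a , refl) ∷ preimages) with map-preimage preimages
  ... | L , refl = a ∷ L , refl

  complete-lift : ∀ {M} → Unique M → CompleteB M
    → ∃[ L ] (Unique L × CompleteA L × length L ≡ length M)
  complete-lift {M} unique (efficient , covers)
    with map-preimage (All.tabulate (λ {b} b∈ → g-onto b (efficient b b∈)))
  ... | L , refl = L , Unique.map⁻ unique , (efficient′ , covers′) , sym (length-map g L)
    where
    efficient′ : ∀ a → a ∈ˡ L → EfficientA a
    efficient′ a a∈ = g-efficient⁻ a (efficient (g a) (∈-map⁺ g a∈))
    covers′ : ∀ a → EfficientA a → ∃[ a′ ] (a′ ∈ˡ L × costA a′ ≡ costA a)
    covers′ a eff with covers (g a) (g-efficient a eff)
    ... | b′ , b′∈ , cb′≡cga with ∈-map⁻ g b′∈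
    ...   | a′ , a′∈ , refl = a′ , a′∈ , trans (g-cost a′) (trans cb′≡cga (sym (g-cost a)))

  minimumComplete-map : ∀ {L} → IsMinimumComplete EfficientA costA L
    → IsMinimumComplete EfficientB costB (map g L)
  minimumComplete-map {L} minimal@(unique , complete , minimum) =
    AllPairs.map⁺ (AllPairs-mapWith∈ g-injective unique) , complete-map complete , minimum′
    where
    g-injective : ∀ {x y} → x ∈ˡ L → y ∈ˡ L → x ≢ y → g x ≢ g y
    g-injective x∈ y∈ x≢y gx≡gy = minimumComplete⇒cost-injective EfficientA costA minimal x∈ y∈ x≢y
      (trans (g-cost _) (trans (cong costB gx≡gy) (sym (g-cost _))))
    minimum′ : ∀ M → Unique M → CompleteB M → length (map g L) ≤ length M
    minimum′ M uniqueM completeM with complete-lift uniqueM completeM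
    ... | L′ , uniqueL′ , completeL′ , length-L′ = begin
      length (map g L)  ≡⟨ length-map g L ⟩
      length L          ≤⟨ minimum L′ uniqueL′ completeL′ ⟩
      length L′         ≡⟨ length-L′ ⟩
      length M          ∎
      where open ≤-Reasoning

module _ (C : CostMonoid) where
  open CostMonoid C

  +-swap : ∀ x y z → x + (y + z) ≡ y + (x + z)
  +-swap x y z = begin
    x + (y + z)  ≡⟨ sym (+-assoc x y z) ⟩
    (x + y) + z  ≡⟨ cong (_+ z) (+-comm x y) ⟩
    (y + x) + z  ≡⟨ +-assoc y x z ⟩
    y + (x + z)  ∎
    where open ≡-Reasoning

  ⊕-swap : ∀ {d} (x y z : Cost C {d}) → _⊕_ C x (_⊕_ C y z) ≡ _⊕_ C y (_⊕_ C x z)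
  ⊕-swap []       []       []       = refl
  ⊕-swap (x ∷ xs) (y ∷ ys) (z ∷ zs) = cong₂ _∷_ (+-swap x y z) (⊕-swap xs ys zs)

  costSum-⊥ : ∀ {d k} (f : Fin k → Cost C {d}) → costSum C f Subset.⊥ ≡ 𝟎 C
  costSum-⊥ {k = ℕ.zero}  f = refl
  costSum-⊥ {k = ℕ.suc k} f = costSum-⊥ (f ∘ suc)

  costSum-⁅⁆∪ : ∀ {d k} (f : Fin k → Cost C {d}) {e : Fin k} {t : Subset k} → e ∉ t
    → costSum C f (⁅ e ⁆ ∪ t) ≡ _⊕_ C (f e) (costSum C f t)
  costSum-⁅⁆∪ f {zero}  {inside ∷ t}  e∉t = contradiction here e∉t
  costSum-⁅⁆∪ f {zero}  {outside ∷ t} e∉t = cong (_⊕_ C (f zero) ∘ costSum C (f ∘ suc)) (∪-identityˡ t)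
  costSum-⁅⁆∪ f {suc e} {inside ∷ t}  e∉t =
    trans (cong (_⊕_ C (f zero)) (costSum-⁅⁆∪ (f ∘ suc) (e∉t ∘ there))) (⊕-swap _ _ _)
  costSum-⁅⁆∪ f {suc e} {outside ∷ t} e∉t = costSum-⁅⁆∪ (f ∘ suc) (e∉t ∘ there)

outside⇒∉ : ∀ {k} {x : Fin k} {W : Subset k} → lookup W x ≡ outside → x ∉ W
outside⇒∉ x-outside x∈W = contradiction (trans (sym ([]=⇒lookup x∈W)) x-outside) λ ()

∉⇒outside : ∀ {k} {x : Fin k} {W : Subset k} → x ∉ W → lookup W x ≡ outside
∉⇒outside {x = x} {W} x∉W with lookup W x in eq
... | outside = refl
... | inside  = contradiction (lookup⇒[]= x W eq) x∉W

∈⁅⁆∪⁻ : ∀ {k} {x y : Fin k} {T : Subset k} → y ∈ ⁅ x ⁆ ∪ T → y ≡ x ⊎ y ∈ T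
∈⁅⁆∪⁻ {x = x} {T = T} y∈ = Sum.map₁ (x∈⁅y⁆⇒x≡y x) (x∈p∪q⁻ ⁅ x ⁆ T y∈)

∈∪⁅⁆⁻ : ∀ {k} {x y : Fin k} {T : Subset k} → y ∈ T ∪ ⁅ x ⁆ → y ∈ T ⊎ y ≡ x
∈∪⁅⁆⁻ {x = x} {T = T} y∈ = Sum.map₂ (x∈⁅y⁆⇒x≡y x) (x∈p∪q⁻ T ⁅ x ⁆ y∈)

∈─⇒∉ : ∀ {k} {x : Fin k} (p q : Subset k) → x ∈ p ─ q → x ∉ q
∈─⇒∉ (_ ∷ p) (inside ∷ q) ()       here
∈─⇒∉ (_ ∷ p) (_ ∷ q)      (there x∈) (there x∈q) = ∈─⇒∉ p q x∈ x∈q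

x∈p-y⇒x≢y : ∀ {k} {x y : Fin k} {p : Subset k} → x ∈ p - y → x ≢ y
x∈p-y⇒x≢y {x = x} {p = p} x∈ refl = ∈─⇒∉ p ⁅ x ⁆ x∈ (x∈⁅x⁆ x)

x∈p∪⁅y⁆∧x≢y⇒x∈p : ∀ {k} {x y : Fin k} {p : Subset k} → x ∈ p ∪ ⁅ y ⁆ → x ≢ y → x ∈ p
x∈p∪⁅y⁆∧x≢y⇒x∈p x∈ x≢y with ∈∪⁅⁆⁻ x∈
... | inj₁ x∈p = x∈p
... | inj₂ x≡y = contradiction x≡y x≢y

module _ {n m : ℕ} (ends : Fin m → Fin n × Fin n) where

  InducedEdge : Subset n → Fin m → Set
  InducedEdge W e = proj₁ (ends e) ∈ W × proj₂ (ends e) ∈ W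

  Joins-sym : ∀ {e u w} → Joins ends e u w → Joins ends e w u
  Joins-sym (inj₁ eq) = inj₂ eq
  Joins-sym (inj₂ eq) = inj₁ eq

  Joins-unique : ∀ {e u w w′} → Joins ends e u w → Joins ends e u w′ → w ≡ w′
  Joins-unique (inj₁ a) (inj₁ b) = ,-injectiveʳ (trans (sym a) b)
  Joins-unique (inj₁ a) (inj₂ b) = trans (,-injectiveʳ (trans (sym a) b)) (,-injectiveˡ (trans (sym a) b))
  Joins-unique (inj₂ a) (inj₁ b) = trans (,-injectiveˡ (trans (sym a) b)) (,-injectiveʳ (trans (sym a) b))
  Joins-unique (inj₂ a) (inj₂ b) = ,-injectiveˡ (trans (sym a) b)

  InducedEdge⁺ : ∀ {W e u w} → Joins ends e u w → u ∈ W → w ∈ W → InducedEdge W e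
  InducedEdge⁺ {W} (inj₁ eq) u∈W w∈W =
    subst (_∈ W) (sym (cong proj₁ eq)) u∈W , subst (_∈ W) (sym (cong proj₂ eq)) w∈W
  InducedEdge⁺ {W} (inj₂ eq) u∈W w∈W =
    subst (_∈ W) (sym (cong proj₁ eq)) w∈W , subst (_∈ W) (sym (cong proj₂ eq)) u∈W

  InducedEdge⁻ : ∀ {W e u w} → Joins ends e u w → InducedEdge W e → u ∈ W × w ∈ W
  InducedEdge⁻ {W} (inj₁ eq) (e₁∈W , e₂∈W) =
    subst (_∈ W) (cong proj₁ eq) e₁∈W , subst (_∈ W) (cong proj₂ eq) e₂∈W
  InducedEdge⁻ {W} (inj₂ eq) (e₁∈W , e₂∈W) =
    subst (_∈ W) (cong proj₂ eq) e₂∈W , subst (_∈ W) (cong proj₁ eq) e₁∈W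

  Conn-mono : ∀ {T T′} → T ⊆ T′ → ∀ {x y} → Conn ends T x y → Conn ends T′ x y
  Conn-mono T⊆T′ here             = here
  Conn-mono T⊆T′ (step e e∈T j c) = step e (T⊆T′ e∈T) j (Conn-mono T⊆T′ c)

  module _ {T : Subset m} where

    Conn-trans : ∀ {x y z} → Conn ends T x y → Conn ends T y z → Conn ends T x z
    Conn-trans here             c′ = c′
    Conn-trans (step e e∈T j c) c′ = step e e∈T j (Conn-trans c c′)

    Conn-sym : ∀ {x y} → Conn ends T x y → Conn ends T y x
    Conn-sym here             = here
    Conn-sym (step e e∈T j c) = Conn-trans (Conn-sym c) (step e e∈T (Joins-sym j) here)

    Conn-joined : ∀ {e u w} → Joins ends e u w
      → Conn ends T (proj₁ (ends e)) (proj₂ (ends e)) → Conn ends T u w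
    Conn-joined (inj₁ eq) c = subst₂ (Conn ends T) (cong proj₁ eq) (cong proj₂ eq) c
    Conn-joined (inj₂ eq) c = Conn-sym (subst₂ (Conn ends T) (cong proj₁ eq) (cong proj₂ eq) c)

    Conn-stays : ∀ {W x y} → (∀ h → h ∈ T → InducedEdge W h) → Conn ends T x y → x ∈ W → y ∈ W
    Conn-stays induced here             x∈W = x∈W
    Conn-stays induced (step h h∈T j c) _   = Conn-stays induced c (proj₂ (InducedEdge⁻ j (induced h h∈T)))

    -- A walk that leaves W through e must return through e to the node it left
    -- from, so both traversals can be cut out.
    Conn-bypass : ∀ {W T′ e} → ¬ InducedEdge W e
      → (∀ h → h ∈ T → h ≢ e → h ∈ T′ × InducedEdge W h)
      → ∀ {x y} → Conn ends T x y → x ∈ W → y ∈ W → Conn ends T′ x y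
    Conn-bypass e-leaves others here _ _ = here
    Conn-bypass {e = e} e-leaves others (step h h∈T j c) x∈W y∈W with h ≟ᶠ e
    ... | no h≢e =
      let h∈T′ , h-induced = others h h∈T h≢e
      in step h h∈T′ j (Conn-bypass e-leaves others c (proj₂ (InducedEdge⁻ j h-induced)) y∈W)
    Conn-bypass e-leaves others (step h h∈T j here) x∈W y∈W | yes refl =
      contradiction (InducedEdge⁺ j x∈W y∈W) e-leaves
    Conn-bypass {e = e} e-leaves others (step h h∈T j (step h′ h′∈T j′ c)) x∈W y∈W | yes refl
      with h′ ≟ᶠ e
    ... | no h′≢e =
      let x′∈W = proj₁ (InducedEdge⁻ j′ (proj₂ (others h′ h′∈T h′≢e)))
      in contradiction (InducedEdge⁺ j x∈W x′∈W) e-leaves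
    ... | yes refl with Joins-unique (Joins-sym j) j′
    ...   | refl = Conn-bypass e-leaves others c x∈W y∈W

  acyclic-extend : ∀ {W F e u w} → (∀ h → h ∈ F → InducedEdge W h) → Acyclic ends F
    → Joins ends e u w → u ∈ W → w ∉ W → Acyclic ends (F ∪ ⁅ e ⁆)
  acyclic-extend {W} {F} {e} induced acyclic j u∈W w∉W g g∈ c with ∈∪⁅⁆⁻ g∈
  ... | inj₂ refl = w∉W (Conn-stays inside-W (Conn-joined j c) u∈W)
    where
    inside-W : ∀ h → h ∈ (F ∪ ⁅ e ⁆) - e → InducedEdge W h
    inside-W h h∈ = induced h (x∈p∪⁅y⁆∧x≢y⇒x∈p (p─q⊆p _ _ h∈) (x∈p-y⇒x≢y h∈))
  ... | inj₁ g∈F =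
    acyclic g g∈F (Conn-bypass e-leaves others c (proj₁ (induced g g∈F)) (proj₂ (induced g g∈F)))
    where
    e-leaves : ¬ InducedEdge W e
    e-leaves e-induced = w∉W (proj₂ (InducedEdge⁻ j e-induced))
    others : ∀ h → h ∈ (F ∪ ⁅ e ⁆) - g → h ≢ e → h ∈ F - g × InducedEdge W h
    others h h∈ h≢e =
      let h∈F = x∈p∪⁅y⁆∧x≢y⇒x∈p (p─q⊆p _ _ h∈) h≢e
      in x∈p∧x≢y⇒x∈p-y h∈F (x∈p-y⇒x≢y h∈) , induced h h∈F

  spanningTree-extend : ∀ {W F e u w} → SpanningTree ends W F → Joins ends e u w → u ∈ W → w ∉ W
    → SpanningTree ends (W ∪ ⁅ w ⁆) (F ∪ ⁅ e ⁆)
  spanningTree-extend {W} {F} {e} {u} {w} (induced , connected , acyclic) j u∈W w∉W =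
    induced′ , connected′ , acyclic-extend induced acyclic j u∈W w∉W
    where
    induced′ : ∀ h → h ∈ F ∪ ⁅ e ⁆ → InducedEdge (W ∪ ⁅ w ⁆) h
    induced′ h h∈ with ∈∪⁅⁆⁻ h∈
    ... | inj₁ h∈F  = Product.map (p⊆p∪q ⁅ w ⁆) (p⊆p∪q ⁅ w ⁆) (induced h h∈F)
    ... | inj₂ refl = InducedEdge⁺ j (p⊆p∪q ⁅ w ⁆ u∈W) (q⊆p∪q W ⁅ w ⁆ (x∈⁅x⁆ w))

    from-u : ∀ x → x ∈ W ∪ ⁅ w ⁆ → Conn ends (F ∪ ⁅ e ⁆) u x
    from-u x x∈ with ∈∪⁅⁆⁻ x∈
    ... | inj₁ x∈W  = Conn-mono (p⊆p∪q ⁅ e ⁆) (connected u x u∈W x∈W)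
    ... | inj₂ refl = step e (q⊆p∪q F ⁅ e ⁆ (x∈⁅x⁆ e)) j here

    connected′ : ∀ x y → x ∈ W ∪ ⁅ w ⁆ → y ∈ W ∪ ⁅ w ⁆ → Conn ends (F ∪ ⁅ e ⁆) x y
    connected′ x y x∈ y∈ = Conn-trans (Conn-sym (from-u x x∈)) (from-u y y∈)

  spanningTree-⁅⁆ : ∀ s → SpanningTree ends ⁅ s ⁆ Subset.⊥
  spanningTree-⁅⁆ s = (λ h h∈⊥ → contradiction h∈⊥ ∉⊥) , connected , (λ h h∈⊥ → contradiction h∈⊥ ∉⊥)
    where
    connected : ∀ u v → u ∈ ⁅ s ⁆ → v ∈ ⁅ s ⁆ → Conn ends Subset.⊥ u v
    connected u v u∈ v∈ rewrite x∈⁅y⁆⇒x≡y s u∈ | x∈⁅y⁆⇒x≡y s v∈ = here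

  spanningTree-extendPath : ∀ {W W′ F} → SpanningTree ends W F → (p : TPath ends W W′)
    → SpanningTree ends W′ (F ∪ pathEdges ends p)
  spanningTree-extendPath {F = F} tree [] = subst (SpanningTree ends _) (sym (∪-identityʳ F)) tree
  spanningTree-extendPath {F = F} tree (arc e u w j u∈W w-out ∷ p) =
    subst (SpanningTree ends _) (∪-assoc F ⁅ e ⁆ (pathEdges ends p))
      (spanningTree-extendPath (spanningTree-extend tree j u∈W (outside⇒∉ w-out)) p)

  pathEdges-spanningTree : ∀ {s W} (p : TPath ends ⁅ s ⁆ W) → SpanningTree ends W (pathEdges ends p)
  pathEdges-spanningTree {s} p =
    subst (SpanningTree ends _) (∪-identityˡ (pathEdges ends p))
      (spanningTree-extendPath (spanningTree-⁅⁆ s) p)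

  pathEdge-¬induced : ∀ {W W′} (p : TPath ends W W′) {h} → h ∈ pathEdges ends p → ¬ InducedEdge W h
  pathEdge-¬induced []                        h∈⊥ _        = ∉⊥ h∈⊥
  pathEdge-¬induced (arc e u w j _ w-out ∷ p) h∈  h-induced with ∈⁅⁆∪⁻ h∈
  ... | inj₁ refl = outside⇒∉ w-out (proj₂ (InducedEdge⁻ j h-induced))
  ... | inj₂ h∈p  = pathEdge-¬induced p h∈p (Product.map (p⊆p∪q ⁅ w ⁆) (p⊆p∪q ⁅ w ⁆) h-induced)

  spanningTree-⊆⇒≡ : ∀ {U t t′} → SpanningTree ends U t′ → SpanningTree ends U t → t′ ⊆ t → t′ ≡ t
  spanningTree-⊆⇒≡ {t = t} {t′} (_ , connected′ , _) (induced , _ , acyclic) t′⊆t =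
    ⊆-antisym t′⊆t t⊆t′
    where
    t⊆t′ : t ⊆ t′
    t⊆t′ {h} h∈t with h ∈? t′
    ... | yes h∈t′ = h∈t′
    ... | no  h∉t′ = contradiction (Conn-mono t′⊆t-h (connected′ _ _ h₁∈U h₂∈U)) (acyclic h h∈t)
      where
      h₁∈U = proj₁ (induced h h∈t)
      h₂∈U = proj₂ (induced h h∈t)
      t′⊆t-h : t′ ⊆ t - h
      t′⊆t-h g∈t′ = x∈p∧x≢y⇒x∈p-y (t′⊆t g∈t′) λ { refl → h∉t′ g∈t′ }

  record CutEdge (T : Subset m) (W : Subset n) : Set where
    constructor cutEdge
    field
      edge        : Fin m
      inner outer : Fin n
      edge∈T      : edge ∈ T
      joins       : Joins ends edge inner outer
      inner∈W     : inner ∈ W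
      outer∉W     : outer ∉ W

  Conn⇒CutEdge : ∀ {T W x y} → Conn ends T x y → x ∈ W → y ∉ W → CutEdge T W
  Conn⇒CutEdge here x∈W y∉W = contradiction x∈W y∉W
  Conn⇒CutEdge {W = W} (step {x = x′} h h∈T j c) x∈W y∉W with x′ ∈? W
  ... | yes x′∈W = Conn⇒CutEdge c x′∈W y∉W
  ... | no  x′∉W = cutEdge h _ x′ h∈T j x∈W x′∉W

  module _ {U : Subset n} {t : Subset m} (t-spans : SpanningTree ends U t) {s : Fin n} (s∈U : s ∈ U) where

    private
      grow : ∀ W → Acc _<_ (n ∸ ∣ W ∣) → W ⊆ U → s ∈ W
        → Σ (TPath ends W U) λ p → pathEdges ends p ⊆ t
      grow W (acc smaller) W⊆U s∈W with any? (λ v → v ∈? U ×-dec ¬? (v ∈? W))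
      ... | no none = subst (λ X → Σ (TPath ends W X) λ p → pathEdges ends p ⊆ t) (⊆-antisym W⊆U U⊆W)
                            ([] , λ h∈⊥ → contradiction h∈⊥ ∉⊥)
        where
        U⊆W : U ⊆ W
        U⊆W {v} v∈U = decidable-stable (v ∈? W) (λ v∉W → none (v , v∈U , v∉W))
      ... | yes (v , v∈U , v∉W) with Conn⇒CutEdge (proj₁ (proj₂ t-spans) s v (W⊆U s∈W) v∈U) s∈W v∉W
      ...   | cutEdge g a b g∈t j a∈W b∉W
              with grow (W ∪ ⁅ b ⁆) (smaller (∸-monoʳ-< W<W′ (∣p∣≤n (W ∪ ⁅ b ⁆))))
                        W′⊆U (p⊆p∪q ⁅ b ⁆ s∈W)
        where
        W<W′ : ∣ W ∣ < ∣ W ∪ ⁅ b ⁆ ∣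
        W<W′ = p⊂q⇒∣p∣<∣q∣ (p⊆p∪q ⁅ b ⁆ , b , q⊆p∪q W ⁅ b ⁆ (x∈⁅x⁆ b) , b∉W)
        W′⊆U : W ∪ ⁅ b ⁆ ⊆ U
        W′⊆U x∈ with ∈∪⁅⁆⁻ x∈
        ... | inj₁ x∈W  = W⊆U x∈W
        ... | inj₂ refl = proj₂ (InducedEdge⁻ j (proj₁ t-spans g g∈t))
      ...     | p , p⊆t = arc g a b j a∈W (∉⇒outside b∉W) ∷ p , edges⊆t
        where
        edges⊆t : ⁅ g ⁆ ∪ pathEdges ends p ⊆ t
        edges⊆t h∈ with ∈⁅⁆∪⁻ h∈
        ... | inj₁ refl = g∈t
        ... | inj₂ h∈p  = p⊆t h∈p

    spanningTree⇒path : Σ (TPath ends ⁅ s ⁆ U) λ p → pathEdges ends p ≡ t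
    spanningTree⇒path with grow ⁅ s ⁆ (<-wellFounded _) ⁅s⁆⊆U (x∈⁅x⁆ s)
      where
      ⁅s⁆⊆U : ⁅ s ⁆ ⊆ U
      ⁅s⁆⊆U x∈ rewrite x∈⁅y⁆⇒x≡y s x∈ = s∈U
    ... | p , p⊆t = p , spanningTree-⊆⇒≡ (pathEdges-spanningTree p) t-spans p⊆t

  module _ (C : CostMonoid) {d : ℕ} (c : Fin m → Cost C {d}) where

    pathCost≡treeCost : ∀ {W W′} (p : TPath ends W W′)
      → pathCost ends C c p ≡ treeCost ends C c (pathEdges ends p)
    pathCost≡treeCost [] = sym (costSum-⊥ C c)
    pathCost≡treeCost (arc e u w j u∈W _ ∷ p) =
      trans (cong (_⊕_ C (c e)) (pathCost≡treeCost p)) (sym (costSum-⁅⁆∪ C c e∉p))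
      where
      e∉p : e ∉ pathEdges ends p
      e∉p e∈p = pathEdge-¬induced p e∈p (InducedEdge⁺ j (p⊆p∪q ⁅ w ⁆ u∈W) (q⊆p∪q _ ⁅ w ⁆ (x∈⁅x⁆ w)))

    module _ {s : Fin n} {U : Subset n} (s∈U : s ∈ U) where

      efficientPath⇒efficientTree : ∀ p → EfficientPath ends C c s U p
        → EfficientTree ends C c U (pathEdges ends p)
      efficientPath⇒efficientTree p efficient = pathEdges-spanningTree p , λ (t′ , t′-spans , t′-dominates) →
        let p′ , p′≡t′ = spanningTree⇒path t′-spans s∈U
        in efficient (p′ , subst₂ (Dominates C)
                             (trans (cong (treeCost ends C c) (sym p′≡t′)) (sym (pathCost≡treeCost p′)))
                             (sym (pathCost≡treeCost p)) t′-dominates)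

      efficientTree⇒efficientPath : ∀ p → EfficientTree ends C c U (pathEdges ends p)
        → EfficientPath ends C c s U p
      efficientTree⇒efficientPath p (_ , efficient) (p′ , p′-dominates) =
        efficient (pathEdges ends p′ , pathEdges-spanningTree p′ ,
                   subst₂ (Dominates C) (pathCost≡treeCost p′) (pathCost≡treeCost p) p′-dominates)

mainTheorem2 : (C : CostMonoid) {d n m : ℕ}
    (ends : Fin m → Fin n × Fin n) (c : Fin m → Cost C {d})
    → Simple ends → Connected ends → (∀ e → NonNeg C (c e))
    → (s : Fin n) (U : Subset n) → s ∈ U
    → (P : List (TPath ends ⁅ s ⁆ U))
    → MinCompletePaths ends C c s U P
    → MinCompleteTrees ends C c U (map (pathEdges ends) P)
    × (∀ p → p ∈ˡ P → pathCost ends C c p ≡ treeCost ends C c (pathEdges ends p))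
mainTheorem2 C ends c _ _ _ s U s∈U P minimal =
  minimumComplete-map (pathEdges ends) (pathCost≡treeCost ends C c)
    (efficientPath⇒efficientTree ends C c s∈U) (efficientTree⇒efficientPath ends C c s∈U)
    (λ t efficient → spanningTree⇒path ends (proj₁ efficient) s∈U) minimal
  , λ p _ → pathCost≡treeCost ends C c p
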